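{- Let $b$ be a queue behavior and let $\mu$ be a sequential witness for $b$. Then there exists a canonical queue behavior $b_c$ such that $b$ and $b_c$ are observationally equivalent and, for every position $i$, the $i$-th element of $b$ is a dequeue event returning $\mathtt{NULL}$ if and only if the $i$-th element of $b_c$ is a dequeue event returning $\mathtt{NULL}$.
   Context: A queue event is a tuple $(u,m,d_{in},d_{out})$ with a globally unique identifier $u$ and method $m\in\{\mathtt{enq},\mathtt{deq}\}$; an enqueue event of value $x\in\mathbb{N}$ is written $\mathtt{enq}(x)$ and a dequeue event returning $x\in\mathbb{N}\cup\{\mathtt{NULL}\}$ is written $\mathtt{deq}(x)$. A queue behavior is a finite duplicate-free sequence of queue events (not necessarily legal). Two behaviors are observationally equivalent if their subsequences of enqueue events coincide and their subsequences of dequeue events coincide. A behavior is canonical if it has the form $\big((\mathtt{deq}(\mathtt{NULL}))^*\cdot\mathtt{enq}(x)\cdot\mathtt{deq}(x)\big)^*\cdot(\mathtt{deq}(\mathtt{NULL}))^*\cdot(\mathtt{enq}(x))^*$, where in each pair $\mathtt{enq}(x)\cdot\mathtt{deq}(x)$ both events carry the same value $x\in\mathbb{N}$. For a behavior $b$: $\mathrm{Enq}(b)$, $\mathrm{Deq}(b)$ are its enqueue and dequeue events, $\mathrm{Val}(b,e)$ the value enqueued or returned by $e$, and $e\prec_b e'$ means $e$ occurs before $e'$ in $b$. A sequential witness for $b$ is a total map $\mu:\mathrm{Deq}(b)\to\mathrm{Enq}(b)\cup\{\bot\}$ such that: (i) $\mu(d)=e$ implies $\mathrm{Val}(b,d)=\mathrm{Val}(b,e)$;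 (ii) $\mu(d)=\bot$ iff $\mathrm{Val}(b,d)=\mathtt{NULL}$; (iii) $\mu(d)=\mu(d')\neq\bot$ implies $d=d'$; (iv) $\mu(d)=e$ implies $e\prec_b d$; (v) if $e\prec_b\mu(d')$ then there is $d$ with $\mu(d)=e$ and $d\prec_b d'$; (vi) $\mu(d)=\bot$ implies $|\{e\in\mathrm{Enq}(b)\mid e\prec_b d\}|=|\{d'\in\mathrm{Deq}(b)\mid d'\prec_b d,\ \mu(d')\neq\bot\}|$. -}

module Defs where

open import Data.Nat using (ℕ; _<ᵇ_)
open import Data.Bool using (Bool; true; false; _∧_)
open import Data.Maybe using (Maybe; just; nothing; is-just)
open import Data.Fin using (Fin; toℕ; _<_)
open import Data.List using (List; []; _∷_; length; lookup; map; filter; allFin)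
open import Data.List.Relation.Unary.Unique.Propositional using (Unique)
open import Data.Product using (Σ; ∃; _×_; _,_)
open import Relation.Binary.PropositionalEquality using (_≡_; _≢_)
open import Relation.Nullary using (¬_)
open import Relation.Nullary.Decidable using (does)
open import Data.Bool.Properties using (T?)

-- The method together with its data: enq x has input x; deq r returns r,
-- where r = nothing encodes NULL.
data Op : Set where
  enq : ℕ → Op
  deq : Maybe ℕ → Op

-- A queue event (u, m, d_in, d_out): unique identifier plus method/data.
record Event : Set where
  constructor ev
  field
    uid : ℕ
    op  : Op
open Event public

val : Event → Maybe ℕ
val e with op e
... | enq x = just x
... | deq r = r

isEnq : Event → Bool
isEnq e with op e
... | enq _ = true
... | deq _ = false

isDeq : Event → Bool
isDeq e with op e
... | enq _ = false
... | deq _ = true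

IsEnq : Event → Set
IsEnq e = isEnq e ≡ true

IsDeq : Event → Set
IsDeq e = isDeq e ≡ true

IsDeqNull : Event → Set
IsDeqNull e = op e ≡ deq nothing

Behavior : Set
Behavior = List Event

DuplicateFree : Behavior → Set
DuplicateFree b = Unique (map uid b)

enqs : Behavior → List Event
enqs b = filter (λ e → T? (isEnq e)) b

deqs : Behavior → List Event
deqs b = filter (λ e → T? (isDeq e)) b

ObsEquiv : Behavior → Behavior → Set
ObsEquiv b b' = (enqs b ≡ enqs b') × (deqs b ≡ deqs b')

-- Canonical behaviors:
--   ((deq NULL)* · enq(x) · deq(x))* · (deq NULL)* · (enq(x))*

data Enqs : Behavior → Set where
  []  : Enqs []
  _∷_ : ∀ {u x l} → Enqs l → Enqs (ev u (enq x) ∷ l)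

data Tail : Behavior → Set where
  enqs-only : ∀ {l} → Enqs l → Tail l
  null∷     : ∀ {u l} → Tail l → Tail (ev u (deq nothing) ∷ l)

data Canonical : Behavior → Set
data Block : Behavior → Set

data Canonical where
  tail  : ∀ {l} → Tail l → Canonical l
  block : ∀ {l} → Block l → Canonical l

data Block where
  pair  : ∀ {u v x l} → Canonical l →
          Block (ev u (enq x) ∷ ev v (deq (just x)) ∷ l)
  null∷ : ∀ {u l} → Block l → Block (ev u (deq nothing) ∷ l)

-- Sequential witnesses (positions in b as Fin (length b); e ≺_b e' is
-- the order of positions).

module _ (b : Behavior) where
  private
    n = length b
    at : Fin n → Event
    at = lookup b

  countᵇ : (Fin n → Bool) → ℕ
  countᵇ p = length (filter (λ i → T? (p i)) (allFin n))

  #enqBefore : Fin n → ℕ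
  #enqBefore d = countᵇ (λ j → (toℕ j <ᵇ toℕ d) ∧ isEnq (at j))

  #matchedDeqBefore : (Fin n → Maybe (Fin n)) → Fin n → ℕ
  #matchedDeqBefore μ d =
    countᵇ (λ j → (toℕ j <ᵇ toℕ d) ∧ isDeq (at j) ∧ is-just (μ j))

  -- μ is given on all positions; only its values on dequeue positions
  -- matter (it is a total map Deq(b) → Enq(b) ∪ {⊥}, ⊥ = nothing).
  record SeqWitness (μ : Fin n → Maybe (Fin n)) : Set where
    field
      codom : ∀ d e → IsDeq (at d) → μ d ≡ just e → IsEnq (at e)
      cond-i   : ∀ d e → IsDeq (at d) → μ d ≡ just e → val (at d) ≡ val (at e)
      cond-ii  : ∀ d → IsDeq (at d) →
                (μ d ≡ nothing → val (at d) ≡ nothing) ×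
                (val (at d) ≡ nothing → μ d ≡ nothing)
      cond-iii : ∀ d d' e → IsDeq (at d) → IsDeq (at d') →
                μ d ≡ just e → μ d' ≡ just e → d ≡ d'
      cond-iv  : ∀ d e → IsDeq (at d) → μ d ≡ just e → e < d
      cond-v   : ∀ e d' e' → IsEnq (at e) → IsDeq (at d') → μ d' ≡ just e' →
                e < e' →
                Σ (Fin n) λ d → IsDeq (at d) × (μ d ≡ just e) × (d < d')
      cond-vi  : ∀ d → IsDeq (at d) → μ d ≡ nothing →
                #enqBefore d ≡ #matchedDeqBefore μ d

_!_ : Behavior → ℕ → Maybe Event
[] ! _ = nothing
(e ∷ l) ! ℕ.zero = just e
(e ∷ l) ! ℕ.suc i = l ! i

DeqNullAt : Behavior → ℕ → Set
DeqNullAt b i = Σ Event λ e → (b ! i ≡ just e) × IsDeqNull e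

module Submission where

-- A sequential witness lets b be replayed on a FIFO queue. After the first k events the queue
-- holds, in increasing order, the enqueues before k that no dequeue before k is matched with:
-- (iii) and (iv) make the enqueue matched by a dequeue pending, (v) puts it at the head, and
-- (vi), compared with the balance |queue| + #matched = #enqueued, forces the queue to be empty
-- at a NULL dequeue. From such a run the canonical behaviour is read off by postponing each
-- enqueue to just before the dequeue that removes it and the unremoved ones to the end. This
-- only moves enqueues past non-NULL dequeues, so the enqueue and dequeue subsequences, the set
-- of identifiers and the positions of the NULL dequeues are unchanged.

open import Defs
open import Data.Bool using (Bool; true; false; _∧_)
open import Data.Empty using (⊥; ⊥-elim)
open import Data.Fin as Fin using (Fin; toℕ; zero; suc)
open import Data.Fin.Properties using (toℕ-injective)
open import Data.List using (List; []; _∷_; [_]; _++_; length; map; lookup; drop; filterᵇ; allFin; tabulate)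
open import Data.List.Properties
  using (∷-injectiveˡ; ∷-injectiveʳ; ++-assoc; ++-identityʳ; length-++; length-map; map-++; map-tabulate; filter-none)
open import Data.List.Membership.Propositional using (_∈_)
open import Data.List.Membership.Propositional.Properties using (∈-++⁺ˡ; ∈-++⁺ʳ)
open import Data.List.Relation.Unary.All as All using (All; []; _∷_)
import Data.List.Relation.Unary.All.Properties as All
open import Data.List.Relation.Unary.AllPairs as AllPairs using (AllPairs; []; _∷_)
import Data.List.Relation.Unary.AllPairs.Properties as AllPairs
open import Data.List.Relation.Unary.Any using (here; there)
open import Data.List.Relation.Binary.Permutation.Propositional
  using (_↭_; prep; ↭-sym; ↭-trans; ↭-reflexive; ↭⇒↭ₛ)
open import Data.List.Relation.Binary.Permutation.Propositional.Properties using (shift; map⁺)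
import Data.List.Relation.Binary.Permutation.Setoid.Properties as PermutationSetoid
open import Data.Maybe using (Maybe; just; nothing; is-just)
open import Data.Maybe.Properties using (just-injective)
open import Data.Nat using (ℕ; zero; suc; _+_; _<ᵇ_; s≤s⁻¹) renaming (_<_ to _<ℕ_)
open import Data.Nat.Properties
  using (+-comm; +-assoc; +-suc; +-identityʳ; n<1+n; m<n⇒m<1+n; m<1+n⇒m<n∨m≡n; <-irrefl; ≤⇒≯; m≢1+n+m)
open import Data.Product using (Σ; ∃; _×_; _,_; proj₁; proj₂)
open import Data.Sum using (_⊎_; inj₁; inj₂)
open import Function using (_∘_)
open import Relation.Binary.PropositionalEquality using (_≡_; refl; sym; trans; cong; cong₂; subst; setoid; module ≡-Reasoning)
open import Relation.Nullary using (¬_)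

-- Legal q b: b runs without failure on a FIFO queue holding the enqueue events q.
data Legal : List Event → Behavior → Set where
  done      : ∀ {q} → Enqs q → Legal q []
  enq-step  : ∀ {q b u x} → Legal (q ++ [ ev u (enq x) ]) b → Legal q (ev u (enq x) ∷ b)
  null-step : ∀ {b u} → Legal [] b → Legal [] (ev u (deq nothing) ∷ b)
  deq-step  : ∀ {q b u v x} → Legal q b → Legal (ev u (enq x) ∷ q) (ev v (deq (just x)) ∷ b)

Enqs-∷ʳ⁻ : ∀ q {e} → Enqs (q ++ [ e ]) → Enqs q
Enqs-∷ʳ⁻ []      _        = []
Enqs-∷ʳ⁻ (_ ∷ q) (_∷_ qs) = _∷_ (Enqs-∷ʳ⁻ q qs)

Legal-Enqs : ∀ {q b} → Legal q b → Enqs q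
Legal-Enqs (done qs)            = qs
Legal-Enqs (enq-step {q = q} L) = Enqs-∷ʳ⁻ q (Legal-Enqs L)
Legal-Enqs (null-step _)        = []
Legal-Enqs (deq-step L)         = _∷_ (Legal-Enqs L)

canonicalise : ∀ {q b} → Legal q b → Behavior
canonicalise (done {q} _)                 = q
canonicalise (enq-step L)                 = canonicalise L
canonicalise (null-step {u = u} L)        = ev u (deq nothing) ∷ canonicalise L
canonicalise (deq-step {u = u} {v} {x} L) = ev u (enq x) ∷ ev v (deq (just x)) ∷ canonicalise L

Canonical-null∷ : ∀ {u l} → Canonical l → Canonical (ev u (deq nothing) ∷ l)
Canonical-null∷ (tail t)  = tail (null∷ t)
Canonical-null∷ (block b) = block (null∷ b)

canonicalise-Canonical : ∀ {q b} (L : Legal q b) → Canonical (canonicalise L)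
canonicalise-Canonical (done qs)     = tail (enqs-only qs)
canonicalise-Canonical (enq-step L)  = canonicalise-Canonical L
canonicalise-Canonical (null-step L) = Canonical-null∷ (canonicalise-Canonical L)
canonicalise-Canonical (deq-step L)  = block (pair (canonicalise-Canonical L))

enqs-Enqs : ∀ {q} → Enqs q → enqs q ≡ q
enqs-Enqs []               = refl
enqs-Enqs (_∷_ {u} {x} qs) = cong (ev u (enq x) ∷_) (enqs-Enqs qs)

deqs-Enqs : ∀ {q} → Enqs q → deqs q ≡ []
deqs-Enqs []       = refl
deqs-Enqs (_∷_ qs) = deqs-Enqs qs

enqs-canonicalise : ∀ {q b} (L : Legal q b) → enqs (canonicalise L) ≡ q ++ enqs b
enqs-canonicalise (done {q} qs)                = trans (enqs-Enqs qs) (sym (++-identityʳ q))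
enqs-canonicalise (enq-step {q} {b} L)         = trans (enqs-canonicalise L) (++-assoc q _ (enqs b))
enqs-canonicalise (null-step L)                = enqs-canonicalise L
enqs-canonicalise (deq-step {u = u} {x = x} L) = cong (ev u (enq x) ∷_) (enqs-canonicalise L)

deqs-canonicalise : ∀ {q b} (L : Legal q b) → deqs (canonicalise L) ≡ deqs b
deqs-canonicalise (done qs)                    = deqs-Enqs qs
deqs-canonicalise (enq-step L)                 = deqs-canonicalise L
deqs-canonicalise (null-step {u = u} L)        = cong (ev u (deq nothing) ∷_) (deqs-canonicalise L)
deqs-canonicalise (deq-step {v = v} {x = x} L) = cong (ev v (deq (just x)) ∷_) (deqs-canonicalise L)

canonicalise-↭ : ∀ {q b} (L : Legal q b) → canonicalise L ↭ q ++ b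
canonicalise-↭ (done {q} _)         = ↭-reflexive (sym (++-identityʳ q))
canonicalise-↭ (enq-step {q} {b} L) = ↭-trans (canonicalise-↭ L) (↭-reflexive (++-assoc q _ b))
canonicalise-↭ (null-step L)        = prep _ (canonicalise-↭ L)
canonicalise-↭ (deq-step {q} {b} {v = v} {x} L) =
  prep _ (↭-trans (prep _ (canonicalise-↭ L)) (↭-sym (shift (ev v (deq (just x))) q b)))

DuplicateFree-resp-↭ : ∀ {b b′} → b ↭ b′ → DuplicateFree b → DuplicateFree b′
DuplicateFree-resp-↭ b↭b′ = PermutationSetoid.Unique-resp-↭ (setoid ℕ) (↭⇒↭ₛ (map⁺ uid b↭b′))

isNullDeq : Event → Bool
isNullDeq (ev _ (deq nothing))  = true
isNullDeq (ev _ (deq (just _))) = false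
isNullDeq (ev _ (enq _))        = false

isNullDeq⁺ : ∀ {e} → IsDeqNull e → isNullDeq e ≡ true
isNullDeq⁺ {ev _ _} refl = refl

isNullDeq⁻ : ∀ {e} → isNullDeq e ≡ true → IsDeqNull e
isNullDeq⁻ {ev _ (deq nothing)} refl = refl

nullMask : Behavior → List Bool
nullMask = map isNullDeq

DeqNullAt-resp : ∀ {b b′} → nullMask b ≡ nullMask b′ → ∀ i → DeqNullAt b i → DeqNullAt b′ i
DeqNullAt-resp {e ∷ b} {e′ ∷ b′} eq zero    (_ , refl , null) =
  e′ , refl , isNullDeq⁻ (trans (sym (∷-injectiveˡ eq)) (isNullDeq⁺ null))
DeqNullAt-resp {e ∷ b} {e′ ∷ b′} eq (suc i) null = DeqNullAt-resp (∷-injectiveʳ eq) i null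

nullMask-Enqs-shift : ∀ {q} b {d} → Enqs q → isNullDeq d ≡ false →
                      nullMask (q ++ d ∷ b) ≡ false ∷ nullMask (q ++ b)
nullMask-Enqs-shift b []       d≢null = cong (_∷ nullMask b) d≢null
nullMask-Enqs-shift b (_∷_ qs) d≢null = cong (false ∷_) (nullMask-Enqs-shift b qs d≢null)

nullMask-canonicalise : ∀ {q b} (L : Legal q b) → nullMask (canonicalise L) ≡ nullMask (q ++ b)
nullMask-canonicalise (done {q} _)         = cong nullMask (sym (++-identityʳ q))
nullMask-canonicalise (enq-step {q} {b} L) =
  trans (nullMask-canonicalise L) (cong nullMask (++-assoc q _ b))
nullMask-canonicalise (null-step L)        = cong (true ∷_) (nullMask-canonicalise L)
nullMask-canonicalise (deq-step {b = b} L) =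
  cong (false ∷_) (trans (cong (false ∷_) (nullMask-canonicalise L))
                         (sym (nullMask-Enqs-shift b (Legal-Enqs L) refl)))

filterᵇ-map : ∀ {A B : Set} (p : B → Bool) (f : A → B) xs →
              filterᵇ p (map f xs) ≡ map f (filterᵇ (p ∘ f) xs)
filterᵇ-map p f []       = refl
filterᵇ-map p f (x ∷ xs) with p (f x)
... | true  = cong (f x ∷_) (filterᵇ-map p f xs)
... | false = filterᵇ-map p f xs

indicator : Bool → ℕ
indicator true  = 1
indicator false = 0

countBelow : ∀ {n} → (Fin n → Bool) → ℕ → ℕ
countBelow {n} p k = length (filterᵇ (λ j → (toℕ j <ᵇ k) ∧ p j) (allFin n))

countBelow-zero : ∀ {n} (p : Fin n → Bool) → countBelow p 0 ≡ 0
countBelow-zero {n} p = cong length (filter-none _ (All.universal (λ _ ()) (allFin n)))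

countBelow-tabulate-suc : ∀ {m} (p : Fin (suc m) → Bool) k →
  length (filterᵇ (λ j → (toℕ j <ᵇ suc k) ∧ p j) (tabulate suc)) ≡ countBelow (p ∘ suc) k
countBelow-tabulate-suc {m} p k = begin
  length (filterᵇ below (tabulate suc))
    ≡⟨ cong (length ∘ filterᵇ below) (map-tabulate (λ j → j) suc) ⟨
  length (filterᵇ below (map suc (allFin m)))
    ≡⟨ cong length (filterᵇ-map below suc (allFin m)) ⟩
  length (map suc (filterᵇ (below ∘ suc) (allFin m)))
    ≡⟨ length-map Fin.suc (filterᵇ (below ∘ suc) (allFin m)) ⟩
  countBelow (p ∘ suc) k
    ∎
  where
  open ≡-Reasoning
  below : Fin (suc m) → Bool
  below j = (toℕ j <ᵇ suc k) ∧ p j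

countBelow-suc : ∀ {m} (p : Fin (suc m) → Bool) k →
                 countBelow p (suc k) ≡ indicator (p zero) + countBelow (p ∘ suc) k
countBelow-suc {m} p k with p zero
... | true  = cong suc (countBelow-tabulate-suc p k)
... | false = countBelow-tabulate-suc p k

countBelow-step : ∀ {n} (p : Fin n → Bool) i →
                  countBelow p (suc (toℕ i)) ≡ countBelow p (toℕ i) + indicator (p i)
countBelow-step p zero = begin
  countBelow p 1                              ≡⟨ countBelow-suc p 0 ⟩
  indicator (p zero) + countBelow (p ∘ suc) 0 ≡⟨ cong (indicator (p zero) +_) (countBelow-zero (p ∘ suc)) ⟩
  indicator (p zero) + 0                      ≡⟨ +-comm (indicator (p zero)) 0 ⟩
  0 + indicator (p zero)                      ≡⟨ cong (_+ indicator (p zero)) (countBelow-zero p) ⟨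
  countBelow p 0 + indicator (p zero)         ∎
  where open ≡-Reasoning
countBelow-step p (suc i) = begin
  countBelow p (suc (suc (toℕ i)))
    ≡⟨ countBelow-suc p (suc (toℕ i)) ⟩
  indicator (p zero) + countBelow (p ∘ suc) (suc (toℕ i))
    ≡⟨ cong (indicator (p zero) +_) (countBelow-step (p ∘ suc) i) ⟩
  indicator (p zero) + (countBelow (p ∘ suc) (toℕ i) + indicator (p (suc i)))
    ≡⟨ +-assoc (indicator (p zero)) _ _ ⟨
  indicator (p zero) + countBelow (p ∘ suc) (toℕ i) + indicator (p (suc i))
    ≡⟨ cong (_+ indicator (p (suc i))) (countBelow-suc p (toℕ i)) ⟨
  countBelow p (suc (toℕ i)) + indicator (p (suc i))
    ∎
  where open ≡-Reasoning

countBelow-accept : ∀ {n} (p : Fin n → Bool) i → p i ≡ true →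
                    countBelow p (suc (toℕ i)) ≡ suc (countBelow p (toℕ i))
countBelow-accept p i pᵢ rewrite countBelow-step p i | pᵢ = +-comm _ 1

countBelow-reject : ∀ {n} (p : Fin n → Bool) i → p i ≡ false →
                    countBelow p (suc (toℕ i)) ≡ countBelow p (toℕ i)
countBelow-reject p i pᵢ rewrite countBelow-step p i | pᵢ = +-identityʳ _

enq-event : ∀ {e x} → IsEnq e → val e ≡ just x → e ≡ ev (uid e) (enq x)
enq-event {ev _ (enq _)} refl refl = refl

Enqs-All : ∀ {q} → All IsEnq q → Enqs q
Enqs-All {[]}                []       = []
Enqs-All {ev _ (enq _) ∷ _}  (_ ∷ es) = _∷_ (Enqs-All es)

drop-∷-lookup : ∀ {A : Set} (xs : List A) k {y ys} → drop k xs ≡ y ∷ ys →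
                ∃ λ (i : Fin (length xs)) → toℕ i ≡ k × lookup xs i ≡ y × drop (suc k) xs ≡ ys
drop-∷-lookup (x ∷ xs) zero    refl = zero , refl , refl , refl
drop-∷-lookup (x ∷ xs) (suc k) eq   with drop-∷-lookup xs k eq
... | i , refl , xᵢ , rest = suc i , refl , xᵢ , rest

module _ (b : Behavior) (μ : Fin (length b) → Maybe (Fin (length b))) (W : SeqWitness b μ) where
  open SeqWitness W

  private
    n : ℕ
    n = length b

    at : Fin n → Event
    at = lookup b

  MatchedBelow : ℕ → Fin n → Set
  MatchedBelow k j = ∃ λ d → toℕ d <ℕ k × IsDeq (at d) × μ d ≡ just j

  matchedDeq : Fin n → Bool
  matchedDeq d = isDeq (at d) ∧ is-just (μ d)

  enqBelow matchedBelow : ℕ → ℕ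
  enqBelow     = countBelow (isEnq ∘ at)
  matchedBelow = countBelow matchedDeq

  record QueueInv (k : ℕ) (q : List (Fin n)) : Set where
    field
      below    : All (λ j → toℕ j <ℕ k) q
      enqueued : All (IsEnq ∘ at) q
      pending  : All (λ j → ¬ MatchedBelow k j) q
      complete : ∀ j → toℕ j <ℕ k → IsEnq (at j) → ¬ MatchedBelow k j → j ∈ q
      sorted   : AllPairs Fin._<_ q
      balance  : length q + matchedBelow k ≡ enqBelow k
  open QueueInv

  below-suc : ∀ {i j : Fin n} → toℕ j <ℕ suc (toℕ i) → toℕ j <ℕ toℕ i ⊎ j ≡ i
  below-suc j<1+i with m<1+n⇒m<n∨m≡n j<1+i
  ... | inj₁ j<i = inj₁ j<i
  ... | inj₂ j≡i = inj₂ (toℕ-injective j≡i)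

  MatchedBelow-suc⁺ : ∀ {k j} → MatchedBelow k j → MatchedBelow (suc k) j
  MatchedBelow-suc⁺ (d , d<k , dd , μd) = d , m<n⇒m<1+n d<k , dd , μd

  MatchedBelow-suc⁻ : ∀ {i j} → MatchedBelow (suc (toℕ i)) j →
                      MatchedBelow (toℕ i) j ⊎ (IsDeq (at i) × μ i ≡ just j)
  MatchedBelow-suc⁻ (d , d<1+i , dd , μd) with below-suc d<1+i
  ... | inj₁ d<i  = inj₁ (d , d<i , dd , μd)
  ... | inj₂ refl = inj₂ (dd , μd)

  initial : QueueInv 0 []
  initial = record
    { below = [] ; enqueued = [] ; pending = [] ; complete = λ _ () ; sorted = []
    ; balance = trans (countBelow-zero matchedDeq) (sym (countBelow-zero (isEnq ∘ at)))
    }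

  unmatched-suc : ∀ {i j} → ¬ MatchedBelow (toℕ i) j → (IsDeq (at i) → μ i ≡ just j → ⊥) →
                  ¬ MatchedBelow (suc (toℕ i)) j
  unmatched-suc ¬m not-at-i m with MatchedBelow-suc⁻ m
  ... | inj₁ m′        = ¬m m′
  ... | inj₂ (dᵢ , μᵢ) = not-at-i dᵢ μᵢ

  complete-suc : ∀ {i q q′} → isEnq (at i) ≡ false → QueueInv (toℕ i) q →
                 (∀ {j} → j ∈ q → ¬ MatchedBelow (suc (toℕ i)) j → j ∈ q′) →
                 ∀ j → toℕ j <ℕ suc (toℕ i) → IsEnq (at j) → ¬ MatchedBelow (suc (toℕ i)) j → j ∈ q′
  complete-suc {i} not-enq inv survives j j<1+i ej ¬m with below-suc j<1+i
  ... | inj₁ j<i = survives (complete inv j j<i ej (¬m ∘ MatchedBelow-suc⁺)) ¬m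
  ... | inj₂ refl with () ← trans (sym ej) not-enq

  enq-inv : ∀ {i q u x} → at i ≡ ev u (enq x) → QueueInv (toℕ i) q → QueueInv (suc (toℕ i)) (q ++ [ i ])
  enq-inv {i} {q} atᵢ inv = record
    { below    = All.++⁺ (All.map m<n⇒m<1+n (below inv)) (n<1+n (toℕ i) ∷ [])
    ; enqueued = All.++⁺ (enqueued inv) (cong isEnq atᵢ ∷ [])
    ; pending  = All.++⁺ (All.map (λ ¬m → unmatched-suc ¬m not-deq) (pending inv)) (never-matched ∷ [])
    ; complete = complete′
    ; sorted   = AllPairs.++⁺ (sorted inv) ([] ∷ []) (All.map (_∷ []) (below inv))
    ; balance  = balance′
    }
    where
    not-deq : ∀ {j} → IsDeq (at i) → μ i ≡ just j → ⊥
    not-deq dᵢ _ with () ← trans (sym dᵢ) (cong isDeq atᵢ)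

    never-matched : ¬ MatchedBelow (suc (toℕ i)) i
    never-matched (d , d<1+i , dd , μd) = ≤⇒≯ (s≤s⁻¹ d<1+i) (cond-iv d i dd μd)

    complete′ : ∀ j → toℕ j <ℕ suc (toℕ i) → IsEnq (at j) → ¬ MatchedBelow (suc (toℕ i)) j → j ∈ q ++ [ i ]
    complete′ j j<1+i ej ¬m with below-suc j<1+i
    ... | inj₁ j<i  = ∈-++⁺ˡ (complete inv j j<i ej (¬m ∘ MatchedBelow-suc⁺))
    ... | inj₂ refl = ∈-++⁺ʳ q (here refl)

    balance′ : length (q ++ [ i ]) + matchedBelow (suc (toℕ i)) ≡ enqBelow (suc (toℕ i))
    balance′ = begin
      length (q ++ [ i ]) + matchedBelow (suc (toℕ i))
        ≡⟨ cong₂ _+_ (length-++ q) (countBelow-reject matchedDeq i (cong (λ e → isDeq e ∧ is-just (μ i)) atᵢ)) ⟩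
      length q + 1 + matchedBelow (toℕ i)  ≡⟨ cong (_+ matchedBelow (toℕ i)) (+-comm (length q) 1) ⟩
      suc (length q + matchedBelow (toℕ i)) ≡⟨ cong suc (balance inv) ⟩
      suc (enqBelow (toℕ i))               ≡⟨ countBelow-accept (isEnq ∘ at) i (cong isEnq atᵢ) ⟨
      enqBelow (suc (toℕ i))               ∎
      where open ≡-Reasoning

  null-inv : ∀ {i u} → at i ≡ ev u (deq nothing) → μ i ≡ nothing →
             QueueInv (toℕ i) [] → QueueInv (suc (toℕ i)) []
  null-inv {i} atᵢ μᵢ inv = record
    { below = [] ; enqueued = [] ; pending = [] ; sorted = []
    ; complete = complete-suc (cong isEnq atᵢ) inv (λ ())
    ; balance  = trans (countBelow-reject matchedDeq i (cong₂ (λ e m → isDeq e ∧ is-just m) atᵢ μᵢ))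
                       (trans (balance inv) (sym (countBelow-reject (isEnq ∘ at) i (cong isEnq atᵢ))))
    }

  deq-inv : ∀ {i e t u x} → at i ≡ ev u (deq (just x)) → μ i ≡ just e →
            QueueInv (toℕ i) (e ∷ t) → QueueInv (suc (toℕ i)) t
  deq-inv {i} {e} {t} atᵢ μᵢ inv = record
    { below    = All.map m<n⇒m<1+n (All.tail (below inv))
    ; enqueued = All.tail (enqueued inv)
    ; pending  = All.zipWith still-pending (All.tail (pending inv) , AllPairs.head (sorted inv))
    ; complete = complete-suc (cong isEnq atᵢ) inv survives
    ; sorted   = AllPairs.tail (sorted inv)
    ; balance  = balance′
    }
    where
    dᵢ : IsDeq (at i)
    dᵢ = cong isDeq atᵢ

    still-pending : ∀ {j} → ¬ MatchedBelow (toℕ i) j × e Fin.< j → ¬ MatchedBelow (suc (toℕ i)) j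
    still-pending (¬m , e<j) = unmatched-suc ¬m λ _ μj →
      <-irrefl (cong toℕ (just-injective (trans (sym μᵢ) μj))) e<j

    survives : ∀ {j} → j ∈ e ∷ t → ¬ MatchedBelow (suc (toℕ i)) j → j ∈ t
    survives (here refl) ¬m = ⊥-elim (¬m (i , n<1+n (toℕ i) , dᵢ , μᵢ))
    survives (there j∈t) _  = j∈t

    balance′ : length t + matchedBelow (suc (toℕ i)) ≡ enqBelow (suc (toℕ i))
    balance′ = begin
      length t + matchedBelow (suc (toℕ i))
        ≡⟨ cong (length t +_) (countBelow-accept matchedDeq i (cong₂ (λ e m → isDeq e ∧ is-just m) atᵢ μᵢ)) ⟩
      length t + suc (matchedBelow (toℕ i)) ≡⟨ +-suc (length t) _ ⟩
      suc (length t + matchedBelow (toℕ i)) ≡⟨ balance inv ⟩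
      enqBelow (toℕ i)                     ≡⟨ countBelow-reject (isEnq ∘ at) i (cong isEnq atᵢ) ⟨
      enqBelow (suc (toℕ i))               ∎
      where open ≡-Reasoning

  queue-empty : ∀ {i q} → IsDeq (at i) → μ i ≡ nothing → QueueInv (toℕ i) q → q ≡ []
  queue-empty {q = []}    _  _  _   = refl
  queue-empty {i} {_ ∷ _} dᵢ μᵢ inv = ⊥-elim (m≢1+n+m _ (sym (trans (balance inv) (cond-vi i dᵢ μᵢ))))

  -- By (v), every enqueue older than the one matched at i is matched before i, so it has left the queue.
  matched-is-head : ∀ {i e q} → IsDeq (at i) → μ i ≡ just e → QueueInv (toℕ i) q → ∃ λ t → q ≡ e ∷ t
  matched-is-head {i} {e} {q} dᵢ μᵢ inv =
    at-head q (complete inv e (cond-iv i e dᵢ μᵢ) (codom i e dᵢ μᵢ) unmatched)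
              (sorted inv) (enqueued inv) (pending inv)
    where
    unmatched : ¬ MatchedBelow (toℕ i) e
    unmatched (d , d<i , dd , μd) with refl ← cond-iii d i e dd dᵢ μd μᵢ = <-irrefl refl d<i

    at-head : ∀ q → e ∈ q → AllPairs Fin._<_ q → All (IsEnq ∘ at) q →
              All (λ j → ¬ MatchedBelow (toℕ i) j) q → ∃ λ t → q ≡ e ∷ t
    at-head (h ∷ t) (here refl) _ _ _ = t , refl
    at-head (h ∷ t) (there e∈t) (h<t ∷ _) (eh ∷ _) (¬mh ∷ _)
      with d , dd , μd , d<i ← cond-v h i e eh dᵢ μᵢ (All.lookup h<t e∈t) = ⊥-elim (¬mh (d , d<i , dd , μd))

  Transition : ℕ → List (Fin n) → Event → Set
  Transition k q e =
    ∃ λ q′ → QueueInv (suc k) q′ × (∀ {rest} → Legal (map at q′) rest → Legal (map at q) (e ∷ rest))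

  queue-step : ∀ i {q} → QueueInv (toℕ i) q → Transition (toℕ i) q (at i)
  queue-step i {q} inv with at i in atᵢ
  ... | ev u (enq x) =
    q ++ [ i ] , enq-inv atᵢ inv , λ L → enq-step (subst (λ s → Legal s _) map-at-snoc L)
    where
    map-at-snoc : map at (q ++ [ i ]) ≡ map at q ++ [ ev u (enq x) ]
    map-at-snoc = trans (map-++ at q [ i ]) (cong (λ e → map at q ++ [ e ]) atᵢ)
  ... | ev u (deq nothing)
    with μᵢ ← proj₂ (cond-ii i (cong isDeq atᵢ)) (cong val atᵢ)
    with refl ← queue-empty (cong isDeq atᵢ) μᵢ inv =
    [] , null-inv atᵢ μᵢ inv , null-step
  ... | ev u (deq (just x)) with μ i in μᵢ
  ...   | nothing with () ← trans (sym (cong val atᵢ)) (proj₁ (cond-ii i (cong isDeq atᵢ)) μᵢ)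
  ...   | just e with t , refl ← matched-is-head (cong isDeq atᵢ) μᵢ inv =
    t , deq-inv atᵢ μᵢ inv , λ L → subst (λ h → Legal (h ∷ map at t) _) (sym atₑ) (deq-step L)
    where
    atₑ : at e ≡ ev (uid (at e)) (enq x)
    atₑ = enq-event (codom i e (cong isDeq atᵢ) μᵢ)
                    (trans (sym (cond-i i e (cong isDeq atᵢ) μᵢ)) (cong val atᵢ))

  legal-from : ∀ k rest {q} → drop k b ≡ rest → QueueInv k q → Legal (map at q) rest
  legal-from k []         _     inv = done (Enqs-All (All.map⁺ (enqueued inv)))
  legal-from k (e ∷ rest) dropₖ inv with drop-∷-lookup b k dropₖ
  ... | i , refl , refl , dropₖ₊₁ with q′ , inv′ , extend ← queue-step i inv =
    extend (legal-from (suc (toℕ i)) rest dropₖ₊₁ inv′)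

  witness⇒Legal : Legal [] b
  witness⇒Legal = legal-from 0 b refl initial

lemma3p8 : (b : Behavior) → DuplicateFree b →
    (μ : Fin (length b) → Maybe (Fin (length b))) → SeqWitness b μ →
    Σ Behavior λ bc → DuplicateFree bc × Canonical bc × ObsEquiv b bc ×
      ((i : ℕ) → (DeqNullAt b i → DeqNullAt bc i) × (DeqNullAt bc i → DeqNullAt b i))
lemma3p8 b b-unique μ W =
  canonicalise L ,
  DuplicateFree-resp-↭ (↭-sym (canonicalise-↭ L)) b-unique ,
  canonicalise-Canonical L ,
  (sym (enqs-canonicalise L) , sym (deqs-canonicalise L)) ,
  λ i → DeqNullAt-resp (sym (nullMask-canonicalise L)) i , DeqNullAt-resp (nullMask-canonicalise L) i
  where
  L : Legal [] b
  L = witness⇒Legal b μ W
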